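{- Let $\mathbf L=(R,\vee,\wedge,{}',0,1)$ be an orthomodular lattice (in particular, any lattice-ordered algebra of $S$-probabilities). Among ring-like structures of events $\mathbf R=(R,\oplus,\cdot,0,1)$ with $\mathbb L(\mathbf R)=\mathbf L$ whose operation $\oplus$ is given by a binary term in $\vee,\wedge,{}'$ (i.e. a term valid as such over orthomodular lattices), there are exactly two, namely those with $x\oplus_1y:=(x\wedge y')\vee(x'\wedge y)$ and $x\oplus_2y:=(x\vee y)\wedge(x'\vee y')$.
   Context: A ring-like structure of events (RLSE) is an algebra $(R,\oplus,\cdot,0,1)$ of type $(2,2,0,0)$ such that $(R,\cdot,1)$ is an idempotent commutative monoid with zero element $0$ (i.e. $x0=0$), satisfying (R1) $x\oplus y= y\oplus x$; (R2) $(xy\oplus1)(x\oplus1)\oplus1= x$; (R3) $((xy\oplus1)x\oplus1)x= xy$; (R4) $xy\oplus(x\oplus1)=(xy\oplus1)x\oplus1$. For such $\mathbf R$, $\mathbb L(\mathbf R):=(R,\vee,\wedge,{}',0,1)$ where $x':=x\oplus1$, $x\wedge y:=xy$, $x\vee y:=(x'y')'$. Equivalently, $\mathbf R$ is an RLSE with $\mathbb L(\mathbf R)=\mathbf L$ iff $xy=x\wedge y$ and $\oplus$ is commutative, satisfies $x\oplus1=x'$, and $x\oplus y=x\vee y$ whenever $x\le y'$. -}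

module Defs where

open import Level using (Level; _⊔_; suc)
open import Relation.Binary.Core using (Rel)
open import Algebra.Core using (Op₁; Op₂)
open import Algebra.Lattice.Structures using (IsLattice)
import Algebra.Structures as AS
import Algebra.Definitions as AD
open import Data.Product using (_×_)
open import Relation.Nullary using (¬_)

record OrthomodularLattice (c ℓ : Level) : Set (suc (c ⊔ ℓ)) where
  infix  4 _≈_ _≤_
  infixr 6 _∨_
  infixr 7 _∧_
  infix  8 _′
  field
    Carrier   : Set c
    _≈_       : Rel Carrier ℓ
    _∨_       : Op₂ Carrier
    _∧_       : Op₂ Carrier
    _′        : Op₁ Carrier
    ⊥         : Carrier
    ⊤         : Carrier
    isLattice : IsLattice _≈_ _∨_ _∧_
    ′-cong    : ∀ {x y} → x ≈ y → x ′ ≈ y ′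
    ∨-identityʳ : ∀ x → x ∨ ⊥ ≈ x
    ∧-identityʳ : ∀ x → x ∧ ⊤ ≈ x
    ∨-complementʳ : ∀ x → x ∨ x ′ ≈ ⊤
    ∧-complementʳ : ∀ x → x ∧ x ′ ≈ ⊥
    ′-involutive  : ∀ x → x ′ ′ ≈ x
    deMorgan      : ∀ x y → (x ∨ y) ′ ≈ x ′ ∧ y ′
  _≤_ : Rel Carrier ℓ
  x ≤ y = x ∧ y ≈ x
  field
    orthomodular : ∀ {x y} → x ≤ y → y ≈ x ∨ (y ∧ x ′)

  open IsLattice isLattice public

record IsRLSE {a ℓ} {A : Set a} (_≈_ : Rel A ℓ)
              (_⊕_ _·_ : Op₂ A) (𝟘 𝟙 : A) : Set (a ⊔ ℓ) where
  field
    ·-isIdempotentCommutativeMonoid : AS.IsIdempotentCommutativeMonoid _≈_ _·_ 𝟙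
    ·-zero  : AD.Zero _≈_ 𝟘 _·_
    ⊕-cong  : AD.Congruent₂ _≈_ _⊕_
    R1 : ∀ x y → (x ⊕ y) ≈ (y ⊕ x)
    R2 : ∀ x y → ((((x · y) ⊕ 𝟙) · (x ⊕ 𝟙)) ⊕ 𝟙) ≈ x
    R3 : ∀ x y → (((((x · y) ⊕ 𝟙) · x) ⊕ 𝟙) · x) ≈ (x · y)
    R4 : ∀ x y → ((x · y) ⊕ (x ⊕ 𝟙)) ≈ ((((x · y) ⊕ 𝟙) · x) ⊕ 𝟙)

data Term : Set where
  varX varY : Term
  _∨ₜ_ _∧ₜ_ : Term → Term → Term
  _′ₜ       : Term → Term

module _ {c ℓ} (L : OrthomodularLattice c ℓ) where
  open OrthomodularLattice L

  ⟦_⟧ : Term → Carrier → Carrier → Carrier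
  ⟦ varX ⟧     x y = x
  ⟦ varY ⟧     x y = y
  ⟦ s ∨ₜ t ⟧   x y = ⟦ s ⟧ x y ∨ ⟦ t ⟧ x y
  ⟦ s ∧ₜ t ⟧   x y = ⟦ s ⟧ x y ∧ ⟦ t ⟧ x y
  ⟦ t ′ₜ ⟧     x y = (⟦ t ⟧ x y) ′

  -- 𝕃(R) = L for R = (Carrier, ⊕, ∧, ⊥, ⊤): the derived operations agree with L's.
  -- (meet, 0, 1 agree by construction since · := ∧.)
  𝕃≡L : Op₂ Carrier → Set (c ⊔ ℓ)
  𝕃≡L _⊕_ = (∀ x → (x ⊕ ⊤) ≈ x ′)
          × (∀ x y → (((x ⊕ ⊤) ∧ (y ⊕ ⊤)) ⊕ ⊤) ≈ x ∨ y)

  RLSEover : Op₂ Carrier → Set (c ⊔ ℓ)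
  RLSEover _⊕_ = IsRLSE _≈_ _⊕_ _∧_ ⊥ ⊤ × 𝕃≡L _⊕_

  _⊕₁_ : Op₂ Carrier
  x ⊕₁ y = (x ∧ y ′) ∨ (x ′ ∧ y)

  _⊕₂_ : Op₂ Carrier
  x ⊕₂ y = (x ∨ y) ∧ (x ′ ∨ y ′)

DefinesRLSE : (c ℓ : Level) → Term → Set (suc (c ⊔ ℓ))
DefinesRLSE c ℓ t = (L : OrthomodularLattice c ℓ) → RLSEover L (⟦_⟧ L t)

EquivTo : (c ℓ : Level) → Term
        → ((L : OrthomodularLattice c ℓ) → Op₂ (OrthomodularLattice.Carrier L))
        → Set (suc (c ⊔ ℓ))
EquivTo c ℓ t op = (L : OrthomodularLattice c ℓ) →
  ∀ x y → OrthomodularLattice._≈_ L (⟦_⟧ L t x y) (op L x y)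

module Submission where

-- Every two-variable term in ∨, ∧, ′ (and ⊤) evaluates, in every orthomodular lattice, to the
-- image of its normal form in 2⁴ × MO₂: the atoms x ∧ y, x ∧ y ′, x ′ ∧ y, x ′ ∧ y ′ and the
-- complement d of their join are pairwise orthogonal with join ⊤, and below d the elements
-- x ∧ d, x ′ ∧ d, y ∧ d, y ′ ∧ d form a copy of MO₂. Identities between terms can thus be
-- checked on normal forms, which verifies the axioms for ⊕₁ and ⊕₂. Conversely, in an RLSE
-- with 𝕃(R) = L the operation ⊕ is commutative and is exclusive or on {⊥, ⊤}; evaluating a
-- defining term in MO₂ at the points of {O, I}² and at (X, Y), (Y, X) forces its normal form to
-- be that of ⊕₁ (MO₂-part O) or of ⊕₂ (MO₂-part I), and the same evaluation separates the two.

open import Defs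
open import Level using (Level; Lift; lift; lower)
open import Data.Bool.Base using (Bool; true; false; not; _xor_) renaming (_∨_ to _∨ᵇ_)
open import Data.Nat.Base using (ℕ)
import Data.Nat.Properties as ℕ
open import Data.Product using (_×_; _,_; proj₁; proj₂)
open import Data.Sum using (_⊎_; inj₁; inj₂)
import Data.Sum as Sum
open import Relation.Nullary using (¬_; contradiction)
open import Relation.Nullary.Decidable using (Dec; map′; _×-dec_; _→-dec_; from-yes)
open import Function.Bundles using (_⇔_; mk⇔)
open import Algebra.Core using (Op₂)
open import Algebra.Bundles using (IdempotentCommutativeMonoid)
open import Algebra.Lattice.Bundles using (Lattice)
import Algebra.Lattice.Properties.Lattice as LatticeProperties
import Algebra.Properties.CommutativeSemigroup as CommutativeSemigroupProperties
import Algebra.Properties.IdempotentCommutativeMonoid as IdempotentCommutativeMonoidProperties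
import Relation.Binary.Lattice.Bundles as OrderTheoretic
import Relation.Binary.Reasoning.Setoid as SetoidReasoning
open import Relation.Binary.Core using (Rel)
open import Relation.Binary.Definitions using (DecidableEquality)
open import Relation.Binary.PropositionalEquality as ≡ using (_≡_; refl; cong)

data MO₂ : Set where
  O I X Xᶜ Y Yᶜ : MO₂

infixr 6 _⊔_
infixr 7 _⊓_
infix  8 _ᶜ

_⊔_ : MO₂ → MO₂ → MO₂
O  ⊔ b  = b
I  ⊔ b  = I
a  ⊔ O  = a
a  ⊔ I  = I
X  ⊔ X  = X
Xᶜ ⊔ Xᶜ = Xᶜ
Y  ⊔ Y  = Y
Yᶜ ⊔ Yᶜ = Yᶜ
_  ⊔ _  = I

_ᶜ : MO₂ → MO₂
O  ᶜ = I
I  ᶜ = O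
X  ᶜ = Xᶜ
Xᶜ ᶜ = X
Y  ᶜ = Yᶜ
Yᶜ ᶜ = Y

_⊓_ : MO₂ → MO₂ → MO₂
a ⊓ b = (a ᶜ ⊔ b ᶜ) ᶜ

swap : MO₂ → MO₂
swap O  = O
swap I  = I
swap X  = Y
swap Xᶜ = Yᶜ
swap Y  = X
swap Yᶜ = Xᶜ

toℕ : MO₂ → ℕ
toℕ O  = 0
toℕ I  = 1
toℕ X  = 2
toℕ Xᶜ = 3
toℕ Y  = 4
toℕ Yᶜ = 5

fromℕ : ℕ → MO₂
fromℕ 0 = O
fromℕ 1 = I
fromℕ 2 = X
fromℕ 3 = Xᶜ
fromℕ 4 = Y
fromℕ _ = Yᶜ

fromℕ-toℕ : ∀ a → fromℕ (toℕ a) ≡ a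
fromℕ-toℕ O  = refl
fromℕ-toℕ I  = refl
fromℕ-toℕ X  = refl
fromℕ-toℕ Xᶜ = refl
fromℕ-toℕ Y  = refl
fromℕ-toℕ Yᶜ = refl

infix 4 _≟_
_≟_ : DecidableEquality MO₂
a ≟ b = map′ toℕ-injective (cong toℕ) (toℕ a ℕ.≟ toℕ b)
  where
  toℕ-injective : toℕ a ≡ toℕ b → a ≡ b
  toℕ-injective eq = ≡.trans (≡.sym (fromℕ-toℕ a)) (≡.trans (cong fromℕ eq) (fromℕ-toℕ b))

all? : {P : MO₂ → Set} → (∀ a → Dec (P a)) → Dec (∀ a → P a)
all? P? = map′ (λ (o , i , x , xᶜ , y , yᶜ) → λ { O → o ; I → i ; X → x ; Xᶜ → xᶜ ; Y → y ; Yᶜ → yᶜ })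
               (λ p → p O , p I , p X , p Xᶜ , p Y , p Yᶜ)
               (P? O ×-dec P? I ×-dec P? X ×-dec P? Xᶜ ×-dec P? Y ×-dec P? Yᶜ)

⊔-comm : ∀ a b → a ⊔ b ≡ b ⊔ a
⊔-comm = from-yes (all? λ a → all? λ b → a ⊔ b ≟ b ⊔ a)

⊔-assoc : ∀ a b c → (a ⊔ b) ⊔ c ≡ a ⊔ (b ⊔ c)
⊔-assoc = from-yes (all? λ a → all? λ b → all? λ c → (a ⊔ b) ⊔ c ≟ a ⊔ (b ⊔ c))

⊓-comm : ∀ a b → a ⊓ b ≡ b ⊓ a
⊓-comm = from-yes (all? λ a → all? λ b → a ⊓ b ≟ b ⊓ a)

⊓-assoc : ∀ a b c → (a ⊓ b) ⊓ c ≡ a ⊓ (b ⊓ c)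
⊓-assoc = from-yes (all? λ a → all? λ b → all? λ c → (a ⊓ b) ⊓ c ≟ a ⊓ (b ⊓ c))

⊔-absorbs-⊓ : ∀ a b → a ⊔ (a ⊓ b) ≡ a
⊔-absorbs-⊓ = from-yes (all? λ a → all? λ b → a ⊔ (a ⊓ b) ≟ a)

⊓-absorbs-⊔ : ∀ a b → a ⊓ (a ⊔ b) ≡ a
⊓-absorbs-⊔ = from-yes (all? λ a → all? λ b → a ⊓ (a ⊔ b) ≟ a)

⊔-identityʳ : ∀ a → a ⊔ O ≡ a
⊔-identityʳ = from-yes (all? λ a → a ⊔ O ≟ a)

⊓-identityʳ : ∀ a → a ⊓ I ≡ a
⊓-identityʳ = from-yes (all? λ a → a ⊓ I ≟ a)

⊔-complementʳ : ∀ a → a ⊔ a ᶜ ≡ I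
⊔-complementʳ = from-yes (all? λ a → a ⊔ a ᶜ ≟ I)

⊓-complementʳ : ∀ a → a ⊓ a ᶜ ≡ O
⊓-complementʳ = from-yes (all? λ a → a ⊓ a ᶜ ≟ O)

ᶜ-involutive : ∀ a → a ᶜ ᶜ ≡ a
ᶜ-involutive = from-yes (all? λ a → a ᶜ ᶜ ≟ a)

ᶜ-deMorgan : ∀ a b → (a ⊔ b) ᶜ ≡ a ᶜ ⊓ b ᶜ
ᶜ-deMorgan = from-yes (all? λ a → all? λ b → (a ⊔ b) ᶜ ≟ a ᶜ ⊓ b ᶜ)

⊓-orthomodular : ∀ a b → a ⊓ b ≡ a → b ≡ a ⊔ (b ⊓ a ᶜ)
⊓-orthomodular = from-yes (all? λ a → all? λ b → a ⊓ b ≟ a →-dec b ≟ a ⊔ (b ⊓ a ᶜ))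

swap-⊔ : ∀ a b → swap (a ⊔ b) ≡ swap a ⊔ swap b
swap-⊔ = from-yes (all? λ a → all? λ b → swap (a ⊔ b) ≟ swap a ⊔ swap b)

swap-ᶜ : ∀ a → swap (a ᶜ) ≡ swap a ᶜ
swap-ᶜ = from-yes (all? λ a → swap (a ᶜ) ≟ swap a ᶜ)

swap-fixed : ∀ a → swap a ≡ a → a ≡ O ⊎ a ≡ I
swap-fixed O  _  = inj₁ refl
swap-fixed I  _  = inj₂ refl
swap-fixed X  ()
swap-fixed Xᶜ ()
swap-fixed Y  ()
swap-fixed Yᶜ ()

mo₂ : (c ℓ : Level) → OrthomodularLattice c ℓ
mo₂ c ℓ = record
  { Carrier   = Lift c MO₂
  ; _≈_       = λ a b → Lift ℓ (lower a ≡ lower b)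
  ; _∨_       = λ a b → lift (lower a ⊔ lower b)
  ; _∧_       = λ a b → lift (lower a ⊓ lower b)
  ; _′        = λ a → lift (lower a ᶜ)
  ; ⊥         = lift O
  ; ⊤         = lift I
  ; isLattice = record
    { isEquivalence = record
      { refl  = lift refl
      ; sym   = λ (lift e) → lift (≡.sym e)
      ; trans = λ (lift e) (lift f) → lift (≡.trans e f)
      }
    ; ∨-comm     = λ a b → lift (⊔-comm (lower a) (lower b))
    ; ∨-assoc    = λ a b c → lift (⊔-assoc (lower a) (lower b) (lower c))
    ; ∨-cong     = λ (lift e) (lift f) → lift (≡.cong₂ _⊔_ e f)
    ; ∧-comm     = λ a b → lift (⊓-comm (lower a) (lower b))
    ; ∧-assoc    = λ a b c → lift (⊓-assoc (lower a) (lower b) (lower c))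
    ; ∧-cong     = λ (lift e) (lift f) → lift (≡.cong₂ _⊓_ e f)
    ; absorptive = (λ a b → lift (⊔-absorbs-⊓ (lower a) (lower b)))
                 , (λ a b → lift (⊓-absorbs-⊔ (lower a) (lower b)))
    }
  ; ′-cong        = λ (lift e) → lift (cong _ᶜ e)
  ; ∨-identityʳ   = λ a → lift (⊔-identityʳ (lower a))
  ; ∧-identityʳ   = λ a → lift (⊓-identityʳ (lower a))
  ; ∨-complementʳ = λ a → lift (⊔-complementʳ (lower a))
  ; ∧-complementʳ = λ a → lift (⊓-complementʳ (lower a))
  ; ′-involutive  = λ a → lift (ᶜ-involutive (lower a))
  ; deMorgan      = λ a b → lift (ᶜ-deMorgan (lower a) (lower b))
  ; orthomodular  = λ {a} {b} (lift e) → lift (⊓-orthomodular (lower a) (lower b) e)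
  }

-- The free orthomodular lattice on x, y is 2⁴ × MO₂: tᵤᵥ says whether the atom xᵘ ∧ yᵛ
-- (with x¹ = x, x⁰ = x ′) lies below an element, and mo is its part below the complement
-- of the commutator of x and y.
record NF : Set where
  constructor ⟨_,_,_,_∣_⟩
  field
    t₁₁ t₁₀ t₀₁ t₀₀ : Bool
    mo              : MO₂
open NF

infixr 6 _∨ₙ_
infixr 7 _∧ₙ_
infix  8 _′ₙ

_∨ₙ_ : NF → NF → NF
n ∨ₙ k = ⟨ t₁₁ n ∨ᵇ t₁₁ k , t₁₀ n ∨ᵇ t₁₀ k , t₀₁ n ∨ᵇ t₀₁ k , t₀₀ n ∨ᵇ t₀₀ k ∣ mo n ⊔ mo k ⟩

_′ₙ : NF → NF
n ′ₙ = ⟨ not (t₁₁ n) , not (t₁₀ n) , not (t₀₁ n) , not (t₀₀ n) ∣ mo n ᶜ ⟩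

_∧ₙ_ : NF → NF → NF
n ∧ₙ k = (n ′ₙ ∨ₙ k ′ₙ) ′ₙ

xₙ yₙ ⊤ₙ : NF
xₙ = ⟨ true , true , false , false ∣ X ⟩
yₙ = ⟨ true , false , true , false ∣ Y ⟩
⊤ₙ = ⟨ true , true , true , true ∣ I ⟩

table : Bool → Bool → NF → Bool
table true  true  = t₁₁
table true  false = t₁₀
table false true  = t₀₁
table false false = t₀₀

record IsTableAt (π : NF → Bool) (u v : Bool) : Set where
  field
    π-x : π xₙ ≡ u
    π-y : π yₙ ≡ v
    π-⊤ : π ⊤ₙ ≡ true
    π-∨ : ∀ n k → π (n ∨ₙ k) ≡ π n ∨ᵇ π k
    π-′ : ∀ n → π (n ′ₙ) ≡ not (π n)

table-isTableAt : ∀ u v → IsTableAt (table u v) u v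
table-isTableAt true  true  =
  record { π-x = refl ; π-y = refl ; π-⊤ = refl ; π-∨ = λ _ _ → refl ; π-′ = λ _ → refl }
table-isTableAt true  false =
  record { π-x = refl ; π-y = refl ; π-⊤ = refl ; π-∨ = λ _ _ → refl ; π-′ = λ _ → refl }
table-isTableAt false true  =
  record { π-x = refl ; π-y = refl ; π-⊤ = refl ; π-∨ = λ _ _ → refl ; π-′ = λ _ → refl }
table-isTableAt false false =
  record { π-x = refl ; π-y = refl ; π-⊤ = refl ; π-∨ = λ _ _ → refl ; π-′ = λ _ → refl }

infixr 6 _∨ₑ_
infixr 7 _∧ₑ_
infix  8 _′ₑ
infixl 9 _⟪_,_⟫

data Expr : Set where
  xₑ yₑ ⊤ₑ  : Expr
  _∨ₑ_ _∧ₑ_ : Expr → Expr → Expr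
  _′ₑ       : Expr → Expr

fromTerm : Term → Expr
fromTerm varX     = xₑ
fromTerm varY     = yₑ
fromTerm (s ∨ₜ t) = fromTerm s ∨ₑ fromTerm t
fromTerm (s ∧ₜ t) = fromTerm s ∧ₑ fromTerm t
fromTerm (t ′ₜ)   = fromTerm t ′ₑ

_⟪_,_⟫ : Expr → Expr → Expr → Expr
xₑ       ⟪ s , t ⟫ = s
yₑ       ⟪ s , t ⟫ = t
⊤ₑ       ⟪ s , t ⟫ = ⊤ₑ
(p ∨ₑ q) ⟪ s , t ⟫ = p ⟪ s , t ⟫ ∨ₑ q ⟪ s , t ⟫
(p ∧ₑ q) ⟪ s , t ⟫ = p ⟪ s , t ⟫ ∧ₑ q ⟪ s , t ⟫
(p ′ₑ)   ⟪ s , t ⟫ = p ⟪ s , t ⟫ ′ₑ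

nf : Expr → NF
nf xₑ       = xₙ
nf yₑ       = yₙ
nf ⊤ₑ       = ⊤ₙ
nf (s ∨ₑ t) = nf s ∨ₙ nf t
nf (s ∧ₑ t) = nf s ∧ₙ nf t
nf (t ′ₑ)   = nf t ′ₙ

infix 4 _≐_
record _≐_ (e₁ e₂ : Expr) : Set where
  constructor same-nf
  field
    nf-≡ : nf e₁ ≡ nf e₂

⊕₁ₑ ⊕₂ₑ : Expr
⊕₁ₑ = xₑ ∧ₑ yₑ ′ₑ ∨ₑ xₑ ′ₑ ∧ₑ yₑ
⊕₂ₑ = (xₑ ∨ₑ yₑ) ∧ₑ (xₑ ′ₑ ∨ₑ yₑ ′ₑ)

module OrthomodularLatticeProperties {c ℓ} (L : OrthomodularLattice c ℓ) where
  open OrthomodularLattice L public hiding (_≤_) renaming (refl to ≈-refl)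

  lattice : Lattice c ℓ
  lattice = record { isLattice = isLattice }

  open LatticeProperties lattice public using (∨-idem; ∧-idem)
  open LatticeProperties lattice using (∨-isSemigroup; ∧-isSemigroup)
  -- the standard library's order a ≤ b ⇔ a ≈ a ∧ b, the symmetric form of the _≤_ in Defs
  open OrderTheoretic.Lattice (LatticeProperties.∨-∧-orderTheoreticLattice lattice) public
    using (_≤_; x≤x∨y; y≤x∨y; ∨-least; x∧y≤x; x∧y≤y; ∧-greatest; ≤-respˡ-≈; ≤-respʳ-≈)
    renaming (reflexive to ≤-reflexive; trans to ≤-trans)
  open SetoidReasoning (Lattice.setoid lattice)

  ∨-identityˡ : ∀ a → ⊥ ∨ a ≈ a
  ∨-identityˡ a = trans (∨-comm ⊥ a) (∨-identityʳ a)

  ∧-identityˡ : ∀ a → ⊤ ∧ a ≈ a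
  ∧-identityˡ a = trans (∧-comm ⊤ a) (∧-identityʳ a)

  ∨-idempotentCommutativeMonoid : IdempotentCommutativeMonoid c ℓ
  ∨-idempotentCommutativeMonoid = record
    { isIdempotentCommutativeMonoid = record
      { isCommutativeMonoid = record
        { isMonoid = record { isSemigroup = ∨-isSemigroup ; identity = ∨-identityˡ , ∨-identityʳ }
        ; comm     = ∨-comm
        }
      ; idem = ∨-idem
      }
    }

  ∧-idempotentCommutativeMonoid : IdempotentCommutativeMonoid c ℓ
  ∧-idempotentCommutativeMonoid = record
    { isIdempotentCommutativeMonoid = record
      { isCommutativeMonoid = record
        { isMonoid = record { isSemigroup = ∧-isSemigroup ; identity = ∧-identityˡ , ∧-identityʳ }
        ; comm     = ∧-comm
        }
      ; idem = ∧-idem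
      }
    }

  open CommutativeSemigroupProperties
    (IdempotentCommutativeMonoid.commutativeSemigroup ∨-idempotentCommutativeMonoid)
    public using () renaming (interchange to ∨-interchange)
  open IdempotentCommutativeMonoidProperties ∧-idempotentCommutativeMonoid
    public using () renaming (∙-distrˡ-∙ to ∧-distribˡ-∧; ∙-distrʳ-∙ to ∧-distribʳ-∧)

  ∨-pairwise : ∀ {a b a₁ b₁ e e₁} → a ∨ a₁ ≈ e → b ∨ b₁ ≈ e₁ → (a ∨ b) ∨ (a₁ ∨ b₁) ≈ e ∨ e₁
  ∨-pairwise p q = trans (∨-interchange _ _ _ _) (∨-cong p q)

  ≤⇒∨≈ : ∀ {a b} → a ≤ b → a ∨ b ≈ b
  ≤⇒∨≈ {a} {b} a≤b = begin
    a ∨ b        ≈⟨ ∨-congʳ a≤b ⟩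
    (a ∧ b) ∨ b  ≈⟨ ∨-comm _ _ ⟩
    b ∨ (a ∧ b)  ≈⟨ ∨-congˡ (∧-comm a b) ⟩
    b ∨ (b ∧ a)  ≈⟨ ∨-absorbs-∧ b a ⟩
    b            ∎

  ′-antitone : ∀ {a b} → a ≤ b → b ′ ≤ a ′
  ′-antitone {a} {b} a≤b = begin
    b ′        ≈⟨ ′-cong (≤⇒∨≈ a≤b) ⟨
    (a ∨ b) ′  ≈⟨ deMorgan a b ⟩
    a ′ ∧ b ′  ≈⟨ ∧-comm _ _ ⟩
    b ′ ∧ a ′  ∎

  ′′ : ∀ a → a ≈ a ′ ′
  ′′ a = sym (′-involutive a)

  ⊤′≈⊥ : ⊤ ′ ≈ ⊥
  ⊤′≈⊥ = trans (sym (∧-identityˡ (⊤ ′))) (∧-complementʳ ⊤)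

  ⊥′≈⊤ : ⊥ ′ ≈ ⊤
  ⊥′≈⊤ = trans (sym (∨-identityˡ (⊥ ′))) (∨-complementʳ ⊥)

  ⊥-minimum : ∀ a → ⊥ ≤ a
  ⊥-minimum a = ≤-respˡ-≈ (∧-complementʳ a) (x∧y≤x a (a ′))

  ⊤-maximum : ∀ a → a ≤ ⊤
  ⊤-maximum a = sym (∧-identityʳ a)

  ∧-zeroˡ : ∀ a → ⊥ ∧ a ≈ ⊥
  ∧-zeroˡ a = sym (⊥-minimum a)

  ∧-zeroʳ : ∀ a → a ∧ ⊥ ≈ ⊥
  ∧-zeroʳ a = trans (∧-comm a ⊥) (∧-zeroˡ a)

  ≤⊥⇒≈⊥ : ∀ {a} → a ≤ ⊥ → a ≈ ⊥
  ≤⊥⇒≈⊥ {a} a≤⊥ = trans a≤⊥ (∧-zeroʳ a)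

  infix 4 _⟂_
  _⟂_ : Rel Carrier ℓ
  a ⟂ b = a ≤ b ′

  ⟂-complement : ∀ a → a ⟂ a ′
  ⟂-complement a = ≤-reflexive (′′ a)

  ⟂-sym : ∀ {a b} → a ⟂ b → b ⟂ a
  ⟂-sym {a} {b} a⟂b = ≤-respˡ-≈ (′-involutive b) (′-antitone a⟂b)

  ⟂-antitone : ∀ {a a₁ b b₁} → a ≤ a₁ → b ≤ b₁ → a₁ ⟂ b₁ → a ⟂ b
  ⟂-antitone a≤a₁ b≤b₁ a₁⟂b₁ = ≤-trans a≤a₁ (≤-trans a₁⟂b₁ (′-antitone b≤b₁))

  ⊥-⟂ : ∀ a → ⊥ ⟂ a
  ⊥-⟂ a = ⊥-minimum (a ′)

  ∨-⟂ : ∀ {a b e} → a ⟂ e → b ⟂ e → a ∨ b ⟂ e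
  ∨-⟂ = ∨-least

  ⟂-∨ : ∀ {a b e} → a ⟂ b → a ⟂ e → a ⟂ b ∨ e
  ⟂-∨ a⟂b a⟂e = ⟂-sym (∨-⟂ (⟂-sym a⟂b) (⟂-sym a⟂e))

  orthomodular-≤ : ∀ {a b} → a ≤ b → b ≈ a ∨ (b ∧ a ′)
  orthomodular-≤ a≤b = orthomodular (sym a≤b)

  orthomodular-≈ : ∀ {a b} → a ≤ b → b ∧ a ′ ≈ ⊥ → b ≈ a
  orthomodular-≈ {a} {b} a≤b b∧a′≈⊥ = begin
    b              ≈⟨ orthomodular-≤ a≤b ⟩
    a ∨ (b ∧ a ′)  ≈⟨ ∨-congˡ b∧a′≈⊥ ⟩
    a ∨ ⊥          ≈⟨ ∨-identityʳ a ⟩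
    a              ∎

  IsOrthoSum : Carrier → Carrier → Carrier → Set ℓ
  IsOrthoSum e a b = a ⟂ b × a ∨ b ≈ e

  module _ {e a b : Carrier} (s : IsOrthoSum e a b) where
    private
      a⟂b   = proj₁ s
      a∨b≈e = proj₂ s

    IsOrthoSum-≤ˡ : a ≤ e
    IsOrthoSum-≤ˡ = ≤-respʳ-≈ a∨b≈e (x≤x∨y a b)

    IsOrthoSum-≤ʳ : b ≤ e
    IsOrthoSum-≤ʳ = ≤-respʳ-≈ a∨b≈e (y≤x∨y a b)

    IsOrthoSum-sym : IsOrthoSum e b a
    IsOrthoSum-sym = ⟂-sym a⟂b , trans (∨-comm b a) a∨b≈e

    IsOrthoSum-resp : ∀ {e₁ a₁ b₁} → e ≈ e₁ → a ≈ a₁ → b ≈ b₁ → IsOrthoSum e₁ a₁ b₁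
    IsOrthoSum-resp e≈e₁ a≈a₁ b≈b₁ =
      ≤-respˡ-≈ a≈a₁ (≤-respʳ-≈ (′-cong b≈b₁) a⟂b) ,
      trans (∨-cong (sym a≈a₁) (sym b≈b₁)) (trans a∨b≈e e≈e₁)

    IsOrthoSum-relativeComplement : e ∧ a ′ ≈ b
    IsOrthoSum-relativeComplement = orthomodular-≈ (∧-greatest IsOrthoSum-≤ʳ (⟂-sym a⟂b)) (begin
      (e ∧ a ′) ∧ b ′  ≈⟨ ∧-assoc _ _ _ ⟩
      e ∧ (a ′ ∧ b ′)  ≈⟨ ∧-congˡ (deMorgan a b) ⟨
      e ∧ (a ∨ b) ′    ≈⟨ ∧-congˡ (′-cong a∨b≈e) ⟩
      e ∧ e ′          ≈⟨ ∧-complementʳ e ⟩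
      ⊥                ∎)

  IsOrthoSum-⊤ : ∀ {a b} → IsOrthoSum ⊤ a b → a ′ ≈ b
  IsOrthoSum-⊤ {a} {b} (a⟂b , a∨b≈⊤) = orthomodular-≈ (⟂-sym a⟂b) (begin
    a ′ ∧ b ′  ≈⟨ deMorgan a b ⟨
    (a ∨ b) ′  ≈⟨ ′-cong a∨b≈⊤ ⟩
    ⊤ ′        ≈⟨ ⊤′≈⊥ ⟩
    ⊥          ∎)

  IsOrthoSum-∨ : ∀ {e a b e₁ a₁ b₁} → e ⟂ e₁ → IsOrthoSum e a b → IsOrthoSum e₁ a₁ b₁ →
                 IsOrthoSum (e ∨ e₁) (a ∨ a₁) (b ∨ b₁)
  IsOrthoSum-∨ e⟂e₁ s s₁ =
    ∨-⟂ (⟂-∨ (proj₁ s) (⟂-antitone (IsOrthoSum-≤ˡ s) (IsOrthoSum-≤ʳ s₁) e⟂e₁))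
        (⟂-∨ (⟂-antitone (IsOrthoSum-≤ˡ s₁) (IsOrthoSum-≤ʳ s) (⟂-sym e⟂e₁)) (proj₁ s₁)) ,
    ∨-pairwise (proj₂ s) (proj₂ s₁)

  IsOrthoSum-cover : ∀ {e a aᶜ b bᶜ} → IsOrthoSum e a aᶜ → IsOrthoSum e b bᶜ → aᶜ ∧ bᶜ ≈ ⊥ →
                     a ∨ b ≈ e
  IsOrthoSum-cover {e} {a} {aᶜ} {b} {bᶜ} sa sb aᶜ∧bᶜ≈⊥ =
    sym (orthomodular-≈ (∨-least (IsOrthoSum-≤ˡ sa) (IsOrthoSum-≤ˡ sb)) (begin
      e ∧ (a ∨ b) ′          ≈⟨ ∧-congˡ (deMorgan a b) ⟩
      e ∧ (a ′ ∧ b ′)        ≈⟨ ∧-distribˡ-∧ e (a ′) (b ′) ⟩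
      (e ∧ a ′) ∧ (e ∧ b ′)  ≈⟨ ∧-cong (IsOrthoSum-relativeComplement sa)
                                        (IsOrthoSum-relativeComplement sb) ⟩
      aᶜ ∧ bᶜ                ≈⟨ aᶜ∧bᶜ≈⊥ ⟩
      ⊥                      ∎))

  split-off : ∀ {u p q} → p ≤ u → q ≤ u ′ → u ≈ p ∨ (u ∧ (p ∨ q) ′)
  split-off {u} {p} {q} p≤u q≤u′ = begin
    u                      ≈⟨ orthomodular-≤ p≤u ⟩
    p ∨ (u ∧ p ′)          ≈⟨ ∨-congˡ (∧-congʳ (⟂-sym q≤u′)) ⟩
    p ∨ ((u ∧ q ′) ∧ p ′)  ≈⟨ ∨-congˡ (∧-assoc _ _ _) ⟩
    p ∨ (u ∧ (q ′ ∧ p ′))  ≈⟨ ∨-congˡ (∧-congˡ (∧-comm _ _)) ⟩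
    p ∨ (u ∧ (p ′ ∧ q ′))  ≈⟨ ∨-congˡ (∧-congˡ (deMorgan p q)) ⟨
    p ∨ (u ∧ (p ∨ q) ′)    ∎

  -- ⊤ = u ∨ u ′ splits by split-off into (p ∨ q) ∨ ((u ∧ d) ∨ (u ′ ∧ d)), with d = (p ∨ q) ′.
  split-off-isOrthoSum : ∀ {u p q} → p ≤ u → q ≤ u ′ →
                         IsOrthoSum ((p ∨ q) ′) (u ∧ (p ∨ q) ′) (u ′ ∧ (p ∨ q) ′)
  split-off-isOrthoSum {u} {p} {q} p≤u q≤u′ =
    ⟂-antitone (x∧y≤x _ _) (x∧y≤x _ _) (⟂-complement u) ,
    sym (orthomodular-≈ (∨-least (x∧y≤y _ _) (x∧y≤y _ _)) d∧e′≈⊥)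
    where
    d = (p ∨ q) ′
    e = (u ∧ d) ∨ (u ′ ∧ d)
    u′-split : u ′ ≈ q ∨ (u ′ ∧ d)
    u′-split = trans (split-off q≤u′ (≤-respʳ-≈ (′′ u) p≤u))
                     (∨-congˡ (∧-congˡ (′-cong (∨-comm q p))))
    ⊤≈ : ⊤ ≈ (p ∨ q) ∨ e
    ⊤≈ = begin
      ⊤                                ≈⟨ ∨-complementʳ u ⟨
      u ∨ u ′                          ≈⟨ ∨-cong (split-off p≤u q≤u′) u′-split ⟩
      (p ∨ (u ∧ d)) ∨ (q ∨ (u ′ ∧ d))  ≈⟨ ∨-interchange _ _ _ _ ⟩
      (p ∨ q) ∨ e                      ∎
    d∧e′≈⊥ : d ∧ e ′ ≈ ⊥
    d∧e′≈⊥ = begin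
      d ∧ e ′              ≈⟨ deMorgan _ _ ⟨
      ((p ∨ q) ∨ e) ′      ≈⟨ ′-cong ⊤≈ ⟨
      ⊤ ′                  ≈⟨ ⊤′≈⊥ ⟩
      ⊥                    ∎

  keep : Bool → Carrier → Carrier
  keep true  p = p
  keep false p = ⊥

  keep-∨ : ∀ u v p → keep u p ∨ keep v p ≈ keep (u ∨ᵇ v) p
  keep-∨ true  true  p = ∨-idem p
  keep-∨ true  false p = ∨-identityʳ p
  keep-∨ false v     p = ∨-identityˡ (keep v p)

  keep-isOrthoSum : ∀ u p → IsOrthoSum p (keep u p) (keep (not u) p)
  keep-isOrthoSum true  p = ≤-respʳ-≈ (sym ⊥′≈⊤) (⊤-maximum p) , ∨-identityʳ p
  keep-isOrthoSum false p = ⊥-⟂ p , ∨-identityˡ p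

  keep-⊤-′ : ∀ u → keep u ⊤ ′ ≈ keep (not u) ⊤
  keep-⊤-′ true  = ⊤′≈⊥
  keep-⊤-′ false = ⊥′≈⊤

  keep-⊤-injective : ¬ ⊤ ≈ ⊥ → ∀ {u v} → keep u ⊤ ≈ keep v ⊤ → u ≡ v
  keep-⊤-injective ⊤≉⊥ {true}  {true}  _   = refl
  keep-⊤-injective ⊤≉⊥ {true}  {false} ⊤≈⊥ = contradiction ⊤≈⊥ ⊤≉⊥
  keep-⊤-injective ⊤≉⊥ {false} {true}  ⊥≈⊤ = contradiction (sym ⊥≈⊤) ⊤≉⊥
  keep-⊤-injective ⊤≉⊥ {false} {false} _   = refl

  ⟦_⟧ₑ : Expr → Carrier → Carrier → Carrier
  ⟦ xₑ ⟧ₑ     x y = x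
  ⟦ yₑ ⟧ₑ     x y = y
  ⟦ ⊤ₑ ⟧ₑ     x y = ⊤
  ⟦ s ∨ₑ t ⟧ₑ x y = ⟦ s ⟧ₑ x y ∨ ⟦ t ⟧ₑ x y
  ⟦ s ∧ₑ t ⟧ₑ x y = ⟦ s ⟧ₑ x y ∧ ⟦ t ⟧ₑ x y
  ⟦ t ′ₑ ⟧ₑ   x y = ⟦ t ⟧ₑ x y ′

  ⟦⟧≡⟦fromTerm⟧ₑ : ∀ t x y → ⟦_⟧ L t x y ≡ ⟦ fromTerm t ⟧ₑ x y
  ⟦⟧≡⟦fromTerm⟧ₑ varX     x y = refl
  ⟦⟧≡⟦fromTerm⟧ₑ varY     x y = refl
  ⟦⟧≡⟦fromTerm⟧ₑ (s ∨ₜ t) x y = ≡.cong₂ _∨_ (⟦⟧≡⟦fromTerm⟧ₑ s x y) (⟦⟧≡⟦fromTerm⟧ₑ t x y)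
  ⟦⟧≡⟦fromTerm⟧ₑ (s ∧ₜ t) x y = ≡.cong₂ _∧_ (⟦⟧≡⟦fromTerm⟧ₑ s x y) (⟦⟧≡⟦fromTerm⟧ₑ t x y)
  ⟦⟧≡⟦fromTerm⟧ₑ (t ′ₜ)   x y = cong _′ (⟦⟧≡⟦fromTerm⟧ₑ t x y)

  ⟦⟧ₑ-cong : ∀ e {x x₁ y y₁} → x ≈ x₁ → y ≈ y₁ → ⟦ e ⟧ₑ x y ≈ ⟦ e ⟧ₑ x₁ y₁
  ⟦⟧ₑ-cong xₑ       x≈x₁ y≈y₁ = x≈x₁
  ⟦⟧ₑ-cong yₑ       x≈x₁ y≈y₁ = y≈y₁
  ⟦⟧ₑ-cong ⊤ₑ       x≈x₁ y≈y₁ = ≈-refl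
  ⟦⟧ₑ-cong (s ∨ₑ t) x≈x₁ y≈y₁ = ∨-cong (⟦⟧ₑ-cong s x≈x₁ y≈y₁) (⟦⟧ₑ-cong t x≈x₁ y≈y₁)
  ⟦⟧ₑ-cong (s ∧ₑ t) x≈x₁ y≈y₁ = ∧-cong (⟦⟧ₑ-cong s x≈x₁ y≈y₁) (⟦⟧ₑ-cong t x≈x₁ y≈y₁)
  ⟦⟧ₑ-cong (t ′ₑ)   x≈x₁ y≈y₁ = ′-cong (⟦⟧ₑ-cong t x≈x₁ y≈y₁)

  ⟦⟧ₑ-⟪⟫ : ∀ p {s t x y a b} → ⟦ s ⟧ₑ x y ≈ a → ⟦ t ⟧ₑ x y ≈ b →
            ⟦ p ⟪ s , t ⟫ ⟧ₑ x y ≈ ⟦ p ⟧ₑ a b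
  ⟦⟧ₑ-⟪⟫ xₑ       s≈a t≈b = s≈a
  ⟦⟧ₑ-⟪⟫ yₑ       s≈a t≈b = t≈b
  ⟦⟧ₑ-⟪⟫ ⊤ₑ       s≈a t≈b = ≈-refl
  ⟦⟧ₑ-⟪⟫ (p ∨ₑ q) s≈a t≈b = ∨-cong (⟦⟧ₑ-⟪⟫ p s≈a t≈b) (⟦⟧ₑ-⟪⟫ q s≈a t≈b)
  ⟦⟧ₑ-⟪⟫ (p ∧ₑ q) s≈a t≈b = ∧-cong (⟦⟧ₑ-⟪⟫ p s≈a t≈b) (⟦⟧ₑ-⟪⟫ q s≈a t≈b)
  ⟦⟧ₑ-⟪⟫ (p ′ₑ)   s≈a t≈b = ′-cong (⟦⟧ₑ-⟪⟫ p s≈a t≈b)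

  record IsInterpretation (h : NF → Carrier) (x y : Carrier) : Set (c Level.⊔ ℓ) where
    field
      h-x : h xₙ ≈ x
      h-y : h yₙ ≈ y
      h-⊤ : h ⊤ₙ ≈ ⊤
      h-∨ : ∀ n k → h (n ∨ₙ k) ≈ h n ∨ h k
      h-′ : ∀ n → h (n ′ₙ) ≈ h n ′

    h-∧ : ∀ n k → h (n ∧ₙ k) ≈ h n ∧ h k
    h-∧ n k = begin
      h ((n ′ₙ ∨ₙ k ′ₙ) ′ₙ)    ≈⟨ h-′ _ ⟩
      h (n ′ₙ ∨ₙ k ′ₙ) ′       ≈⟨ ′-cong (h-∨ _ _) ⟩
      (h (n ′ₙ) ∨ h (k ′ₙ)) ′  ≈⟨ ′-cong (∨-cong (h-′ n) (h-′ k)) ⟩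
      (h n ′ ∨ h k ′) ′        ≈⟨ deMorgan _ _ ⟩
      h n ′ ′ ∧ h k ′ ′        ≈⟨ ∧-cong (′-involutive _) (′-involutive _) ⟩
      h n ∧ h k                ∎

    interpret : ∀ e → ⟦ e ⟧ₑ x y ≈ h (nf e)
    interpret xₑ       = sym h-x
    interpret yₑ       = sym h-y
    interpret ⊤ₑ       = sym h-⊤
    interpret (s ∨ₑ t) = trans (∨-cong (interpret s) (interpret t)) (sym (h-∨ _ _))
    interpret (s ∧ₑ t) = trans (∧-cong (interpret s) (interpret t)) (sym (h-∧ _ _))
    interpret (t ′ₑ)   = trans (′-cong (interpret t)) (sym (h-′ _))

  boolean-point : ∀ u v → IsInterpretation (λ n → keep (table u v n) ⊤) (keep u ⊤) (keep v ⊤)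
  boolean-point u v = record
    { h-x = reflexive (cong (λ b → keep b ⊤) π-x)
    ; h-y = reflexive (cong (λ b → keep b ⊤) π-y)
    ; h-⊤ = reflexive (cong (λ b → keep b ⊤) π-⊤)
    ; h-∨ = λ n k → trans (reflexive (cong (λ b → keep b ⊤) (π-∨ n k)))
                          (sym (keep-∨ (table u v n) (table u v k) ⊤))
    ; h-′ = λ n → trans (reflexive (cong (λ b → keep b ⊤) (π-′ n))) (sym (keep-⊤-′ (table u v n)))
    }
    where open IsTableAt (table-isTableAt u v)

  module MO₂-Embedding {d a aᶜ b bᶜ : Carrier}
    (a-isOrthoSum : IsOrthoSum d a aᶜ) (b-isOrthoSum : IsOrthoSum d b bᶜ)
    (a∧b≈⊥ : a ∧ b ≈ ⊥) (a∧bᶜ≈⊥ : a ∧ bᶜ ≈ ⊥) (aᶜ∧b≈⊥ : aᶜ ∧ b ≈ ⊥) (aᶜ∧bᶜ≈⊥ : aᶜ ∧ bᶜ ≈ ⊥)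
    where

    μ : MO₂ → Carrier
    μ O  = ⊥
    μ I  = d
    μ X  = a
    μ Xᶜ = aᶜ
    μ Y  = b
    μ Yᶜ = bᶜ

    μ-isOrthoSum : ∀ m → IsOrthoSum d (μ m) (μ (m ᶜ))
    μ-isOrthoSum O  = ⊥-⟂ d , ∨-identityˡ d
    μ-isOrthoSum I  = ⟂-sym (⊥-⟂ d) , ∨-identityʳ d
    μ-isOrthoSum X  = a-isOrthoSum
    μ-isOrthoSum Xᶜ = IsOrthoSum-sym a-isOrthoSum
    μ-isOrthoSum Y  = b-isOrthoSum
    μ-isOrthoSum Yᶜ = IsOrthoSum-sym b-isOrthoSum

    μ-≤ : ∀ m → μ m ≤ d
    μ-≤ m = IsOrthoSum-≤ˡ (μ-isOrthoSum m)

    private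
      cover : ∀ m n → μ (m ᶜ) ∧ μ (n ᶜ) ≈ ⊥ → μ m ∨ μ n ≈ d
      cover m n = IsOrthoSum-cover (μ-isOrthoSum m) (μ-isOrthoSum n)

    μ-∨ : ∀ m n → μ m ∨ μ n ≈ μ (m ⊔ n)
    μ-∨ O  n  = ∨-identityˡ (μ n)
    μ-∨ I  n  = trans (∨-comm d (μ n)) (≤⇒∨≈ (μ-≤ n))
    μ-∨ X  O  = ∨-identityʳ a
    μ-∨ X  I  = ≤⇒∨≈ (μ-≤ X)
    μ-∨ X  X  = ∨-idem a
    μ-∨ X  Xᶜ = proj₂ (μ-isOrthoSum X)
    μ-∨ X  Y  = cover X Y aᶜ∧bᶜ≈⊥
    μ-∨ X  Yᶜ = cover X Yᶜ aᶜ∧b≈⊥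
    μ-∨ Xᶜ O  = ∨-identityʳ aᶜ
    μ-∨ Xᶜ I  = ≤⇒∨≈ (μ-≤ Xᶜ)
    μ-∨ Xᶜ X  = proj₂ (μ-isOrthoSum Xᶜ)
    μ-∨ Xᶜ Xᶜ = ∨-idem aᶜ
    μ-∨ Xᶜ Y  = cover Xᶜ Y a∧bᶜ≈⊥
    μ-∨ Xᶜ Yᶜ = cover Xᶜ Yᶜ a∧b≈⊥
    μ-∨ Y  O  = ∨-identityʳ b
    μ-∨ Y  I  = ≤⇒∨≈ (μ-≤ Y)
    μ-∨ Y  X  = cover Y X (trans (∧-comm bᶜ aᶜ) aᶜ∧bᶜ≈⊥)
    μ-∨ Y  Xᶜ = cover Y Xᶜ (trans (∧-comm bᶜ a) a∧bᶜ≈⊥)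
    μ-∨ Y  Y  = ∨-idem b
    μ-∨ Y  Yᶜ = proj₂ (μ-isOrthoSum Y)
    μ-∨ Yᶜ O  = ∨-identityʳ bᶜ
    μ-∨ Yᶜ I  = ≤⇒∨≈ (μ-≤ Yᶜ)
    μ-∨ Yᶜ X  = cover Yᶜ X (trans (∧-comm b aᶜ) aᶜ∧b≈⊥)
    μ-∨ Yᶜ Xᶜ = cover Yᶜ Xᶜ (trans (∧-comm b a) a∧b≈⊥)
    μ-∨ Yᶜ Y  = proj₂ (μ-isOrthoSum Yᶜ)
    μ-∨ Yᶜ Yᶜ = ∨-idem bᶜ

  -- com is Kalmbach's commutator of x and y (x, y commute iff com ≈ ⊤); below d = com ′
  -- the elements x ∧ d, x ′ ∧ d, y ∧ d, y ′ ∧ d generate a copy of MO₂.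
  module Commutator (x y : Carrier) where

    com d : Carrier
    com = ((x ∧ y) ∨ (x ∧ y ′)) ∨ ((x ′ ∧ y) ∨ (x ′ ∧ y ′))
    d   = com ′

    com≈ : com ≈ ((x ∧ y) ∨ (x ′ ∧ y)) ∨ ((x ∧ y ′) ∨ (x ′ ∧ y ′))
    com≈ = ∨-interchange _ _ _ _

    x-atoms≤x : (x ∧ y) ∨ (x ∧ y ′) ≤ x
    x-atoms≤x = ∨-least (x∧y≤x _ _) (x∧y≤x _ _)

    x′-atoms≤x′ : (x ′ ∧ y) ∨ (x ′ ∧ y ′) ≤ x ′
    x′-atoms≤x′ = ∨-least (x∧y≤x _ _) (x∧y≤x _ _)

    y-atoms≤y : (x ∧ y) ∨ (x ′ ∧ y) ≤ y
    y-atoms≤y = ∨-least (x∧y≤y _ _) (x∧y≤y _ _)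

    y′-atoms≤y′ : (x ∧ y ′) ∨ (x ′ ∧ y ′) ≤ y ′
    y′-atoms≤y′ = ∨-least (x∧y≤y _ _) (x∧y≤y _ _)

    x-split : x ≈ ((x ∧ y) ∨ (x ∧ y ′)) ∨ (x ∧ d)
    x-split = split-off x-atoms≤x x′-atoms≤x′

    y-split : y ≈ ((x ∧ y) ∨ (x ′ ∧ y)) ∨ (y ∧ d)
    y-split = trans (split-off y-atoms≤y y′-atoms≤y′) (∨-congˡ (∧-congˡ (′-cong (sym com≈))))

    x-isOrthoSum : IsOrthoSum d (x ∧ d) (x ′ ∧ d)
    x-isOrthoSum = split-off-isOrthoSum x-atoms≤x x′-atoms≤x′

    y-isOrthoSum : IsOrthoSum d (y ∧ d) (y ′ ∧ d)
    y-isOrthoSum = IsOrthoSum-resp (split-off-isOrthoSum y-atoms≤y y′-atoms≤y′) d≈ (∧-congˡ d≈) (∧-congˡ d≈)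
      where
      d≈ = ′-cong (sym com≈)

    disjoint-below-d : ∀ {u v} → u ∧ v ≤ com → (u ∧ d) ∧ (v ∧ d) ≈ ⊥
    disjoint-below-d {u} {v} u∧v≤com = ≤⊥⇒≈⊥ (≤-respˡ-≈ (∧-distribʳ-∧ d u v)
      (≤-respʳ-≈ (∧-complementʳ com) (∧-greatest (≤-trans (x∧y≤x _ _) u∧v≤com) (x∧y≤y _ _))))

    open MO₂-Embedding x-isOrthoSum y-isOrthoSum
      (disjoint-below-d (≤-trans (x≤x∨y _ _) (x≤x∨y _ _)))
      (disjoint-below-d (≤-trans (y≤x∨y _ _) (x≤x∨y _ _)))
      (disjoint-below-d (≤-trans (x≤x∨y _ _) (y≤x∨y _ _)))
      (disjoint-below-d (≤-trans (y≤x∨y _ _) (y≤x∨y _ _)))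

    ⟦_⟧ₙ : NF → Carrier
    ⟦ n ⟧ₙ = ((keep (t₁₁ n) (x ∧ y)   ∨ keep (t₁₀ n) (x ∧ y ′))
            ∨ (keep (t₀₁ n) (x ′ ∧ y) ∨ keep (t₀₀ n) (x ′ ∧ y ′)))
            ∨ μ (mo n)

    ⟦⟧ₙ-∨ : ∀ n k → ⟦ n ∨ₙ k ⟧ₙ ≈ ⟦ n ⟧ₙ ∨ ⟦ k ⟧ₙ
    ⟦⟧ₙ-∨ n k = sym (∨-pairwise
      (∨-pairwise (∨-pairwise (keep-∨ (t₁₁ n) (t₁₁ k) _) (keep-∨ (t₁₀ n) (t₁₀ k) _))
                  (∨-pairwise (keep-∨ (t₀₁ n) (t₀₁ k) _) (keep-∨ (t₀₀ n) (t₀₀ k) _)))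
      (μ-∨ (mo n) (mo k)))

    ⟦⟧ₙ-isOrthoSum : ∀ n → IsOrthoSum ⊤ ⟦ n ⟧ₙ ⟦ n ′ₙ ⟧ₙ
    ⟦⟧ₙ-isOrthoSum n = IsOrthoSum-resp
      (IsOrthoSum-∨ (⟂-complement com)
        (IsOrthoSum-∨ (⟂-antitone x-atoms≤x x′-atoms≤x′ (⟂-complement x))
          (IsOrthoSum-∨ (⟂-antitone (x∧y≤y _ _) (x∧y≤y _ _) (⟂-complement y))
                        (keep-isOrthoSum (t₁₁ n) _) (keep-isOrthoSum (t₁₀ n) _))
          (IsOrthoSum-∨ (⟂-antitone (x∧y≤y _ _) (x∧y≤y _ _) (⟂-complement y))
                        (keep-isOrthoSum (t₀₁ n) _) (keep-isOrthoSum (t₀₀ n) _)))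
        (μ-isOrthoSum (mo n)))
      (∨-complementʳ com) ≈-refl ≈-refl

    ⟦⟧ₙ-isInterpretation : IsInterpretation ⟦_⟧ₙ x y
    ⟦⟧ₙ-isInterpretation = record
      { h-x = trans (∨-congʳ (∨-congˡ (∨-identityʳ ⊥))) (trans (∨-congʳ (∨-identityʳ _)) (sym x-split))
      ; h-y = trans (∨-congʳ (∨-cong (∨-identityʳ _) (∨-identityʳ _))) (sym y-split)
      ; h-⊤ = ∨-complementʳ com
      ; h-∨ = ⟦⟧ₙ-∨
      ; h-′ = λ n → sym (IsOrthoSum-⊤ (⟦⟧ₙ-isOrthoSum n))
      }

  ≈-by-nf : ∀ {e₁ e₂} → e₁ ≐ e₂ → ∀ x y → ⟦ e₁ ⟧ₑ x y ≈ ⟦ e₂ ⟧ₑ x y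
  ≈-by-nf {e₁} {e₂} (same-nf nf≡) x y = begin
    ⟦ e₁ ⟧ₑ x y  ≈⟨ interpret e₁ ⟩
    ⟦ nf e₁ ⟧ₙ   ≡⟨ cong ⟦_⟧ₙ nf≡ ⟩
    ⟦ nf e₂ ⟧ₙ   ≈⟨ interpret e₂ ⟨
    ⟦ e₂ ⟧ₑ x y  ∎
    where
    open Commutator x y
    open IsInterpretation ⟦⟧ₙ-isInterpretation

record RLSELaws (p : Expr) : Set where
  field
    R1   : p ≐ p ⟪ yₑ , xₑ ⟫
    R2   : p ⟪ p ⟪ xₑ ∧ₑ yₑ , ⊤ₑ ⟫ ∧ₑ p ⟪ xₑ , ⊤ₑ ⟫ , ⊤ₑ ⟫ ≐ xₑ
    R3   : p ⟪ p ⟪ xₑ ∧ₑ yₑ , ⊤ₑ ⟫ ∧ₑ xₑ , ⊤ₑ ⟫ ∧ₑ xₑ ≐ xₑ ∧ₑ yₑ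
    R4   : p ⟪ xₑ ∧ₑ yₑ , p ⟪ xₑ , ⊤ₑ ⟫ ⟫ ≐ p ⟪ p ⟪ xₑ ∧ₑ yₑ , ⊤ₑ ⟫ ∧ₑ xₑ , ⊤ₑ ⟫
    𝕃-′  : p ⟪ xₑ , ⊤ₑ ⟫ ≐ xₑ ′ₑ
    𝕃-∨  : p ⟪ p ⟪ xₑ , ⊤ₑ ⟫ ∧ₑ p ⟪ yₑ , ⊤ₑ ⟫ , ⊤ₑ ⟫ ≐ xₑ ∨ₑ yₑ

⊕₁-laws : RLSELaws ⊕₁ₑ
⊕₁-laws = record
  { R1 = same-nf refl ; R2 = same-nf refl ; R3 = same-nf refl ; R4 = same-nf refl
  ; 𝕃-′ = same-nf refl ; 𝕃-∨ = same-nf refl }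

⊕₂-laws : RLSELaws ⊕₂ₑ
⊕₂-laws = record
  { R1 = same-nf refl ; R2 = same-nf refl ; R3 = same-nf refl ; R4 = same-nf refl
  ; 𝕃-′ = same-nf refl ; 𝕃-∨ = same-nf refl }

module RLSEProperties {c ℓ} (L : OrthomodularLattice c ℓ) where
  open OrthomodularLatticeProperties L
  open SetoidReasoning (Lattice.setoid lattice)

  RLSEover-byNormalForms : ∀ p → RLSELaws p → RLSEover L ⟦ p ⟧ₑ
  RLSEover-byNormalForms p laws = record
    { ·-isIdempotentCommutativeMonoid =
        IdempotentCommutativeMonoid.isIdempotentCommutativeMonoid ∧-idempotentCommutativeMonoid
    ; ·-zero = ∧-zeroˡ , ∧-zeroʳ
    ; ⊕-cong = ⟦⟧ₑ-cong p
    ; R1     = λ x y → trans (≈-by-nf R1 x y) (⟦⟧ₑ-⟪⟫ p ≈-refl ≈-refl)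
    ; R2     = λ x y → trans
        (sym (⟦⟧ₑ-⟪⟫ p (∧-cong (⟦⟧ₑ-⟪⟫ p ≈-refl ≈-refl) (⟦⟧ₑ-⟪⟫ p ≈-refl ≈-refl)) ≈-refl))
        (≈-by-nf R2 x y)
    ; R3     = λ x y → trans (sym (∧-congʳ (⟦⟧ₑ-⟪⟫ p (∧-congʳ (⟦⟧ₑ-⟪⟫ p ≈-refl ≈-refl)) ≈-refl)))
                             (≈-by-nf R3 x y)
    ; R4     = λ x y → trans
        (sym (⟦⟧ₑ-⟪⟫ p ≈-refl (⟦⟧ₑ-⟪⟫ p ≈-refl ≈-refl)))
        (trans (≈-by-nf R4 x y) (⟦⟧ₑ-⟪⟫ p (∧-congʳ (⟦⟧ₑ-⟪⟫ p ≈-refl ≈-refl)) ≈-refl))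
    } ,
    (λ x → trans (sym (⟦⟧ₑ-⟪⟫ p ≈-refl ≈-refl)) (≈-by-nf 𝕃-′ x x)) ,
    (λ x y → trans (sym (⟦⟧ₑ-⟪⟫ p (∧-cong (⟦⟧ₑ-⟪⟫ p ≈-refl ≈-refl) (⟦⟧ₑ-⟪⟫ p ≈-refl ≈-refl)) ≈-refl))
                   (≈-by-nf 𝕃-∨ x y))
    where open RLSELaws laws

  RLSEover-resp : ∀ {_⊕_ _⊕′_ : Op₂ Carrier} → (∀ x y → x ⊕′ y ≈ x ⊕ y) →
                  RLSEover L _⊕_ → RLSEover L _⊕′_
  RLSEover-resp {_⊕_} {_⊕′_} ⊕′≈⊕ (R , ⊕⊤≈′ , ⊕⊤-∨) = record
    { ·-isIdempotentCommutativeMonoid = ·-isIdempotentCommutativeMonoid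
    ; ·-zero = ·-zero
    ; ⊕-cong = λ a≈b u≈v → trans (⊕′≈⊕-cong a≈b u≈v) (sym (⊕′≈⊕ _ _))
    ; R1 = λ x y → trans (⊕′≈⊕ x y) (trans (R1 x y) (sym (⊕′≈⊕ y x)))
    ; R2 = λ x y → trans (⊕′≈⊕-cong (∧-cong (⊕′≈⊕-cong ≈-refl ≈-refl) (⊕′≈⊕-cong ≈-refl ≈-refl)) ≈-refl)
                         (R2 x y)
    ; R3 = λ x y → trans (∧-congʳ (⊕′≈⊕-cong (∧-congʳ (⊕′≈⊕-cong ≈-refl ≈-refl)) ≈-refl)) (R3 x y)
    ; R4 = λ x y → trans (⊕′≈⊕-cong ≈-refl (⊕′≈⊕-cong ≈-refl ≈-refl))
                         (trans (R4 x y) (sym (⊕′≈⊕-cong (∧-congʳ (⊕′≈⊕-cong ≈-refl ≈-refl)) ≈-refl)))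
    } ,
    (λ x → trans (⊕′≈⊕ x ⊤) (⊕⊤≈′ x)) ,
    (λ x y → trans (⊕′≈⊕-cong (∧-cong (⊕′≈⊕-cong ≈-refl ≈-refl) (⊕′≈⊕-cong ≈-refl ≈-refl)) ≈-refl)
                   (⊕⊤-∨ x y))
    where
    open IsRLSE R
    ⊕′≈⊕-cong : ∀ {a b u v} → a ≈ b → u ≈ v → a ⊕′ u ≈ b ⊕ v
    ⊕′≈⊕-cong a≈b u≈v = trans (⊕′≈⊕ _ _) (⊕-cong a≈b u≈v)

  module _ {_⊕_ : Op₂ Carrier} (rlse : RLSEover L _⊕_) where
    open IsRLSE (proj₁ rlse)
    private
      ⊕⊤≈′ = proj₁ (proj₂ rlse)

    ⊕-identityʳ : ∀ y → y ⊕ ⊥ ≈ y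
    ⊕-identityʳ y = begin
      y ⊕ ⊥                      ≈⟨ ⊕-cong (∧-identityˡ y) (trans (⊕⊤≈′ ⊤) ⊤′≈⊥) ⟨
      (⊤ ∧ y) ⊕ (⊤ ⊕ ⊤)          ≈⟨ R4 ⊤ y ⟩
      (((⊤ ∧ y) ⊕ ⊤) ∧ ⊤) ⊕ ⊤    ≈⟨ ⊕⊤≈′ _ ⟩
      (((⊤ ∧ y) ⊕ ⊤) ∧ ⊤) ′      ≈⟨ ′-cong (∧-identityʳ _) ⟩
      ((⊤ ∧ y) ⊕ ⊤) ′            ≈⟨ ′-cong (⊕⊤≈′ _) ⟩
      (⊤ ∧ y) ′ ′                ≈⟨ ′-involutive _ ⟩
      ⊤ ∧ y                      ≈⟨ ∧-identityˡ y ⟩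
      y                          ∎

    ⊕-bounds-xor : ∀ u v → keep u ⊤ ⊕ keep v ⊤ ≈ keep (u xor v) ⊤
    ⊕-bounds-xor true  true  = trans (⊕⊤≈′ ⊤) ⊤′≈⊥
    ⊕-bounds-xor true  false = ⊕-identityʳ ⊤
    ⊕-bounds-xor false true  = trans (⊕⊤≈′ ⊥) ⊥′≈⊤
    ⊕-bounds-xor false false = ⊕-identityʳ ⊥

xor-normal-forms : ∀ n → (∀ u v → table u v n ≡ u xor v) → swap (mo n) ≡ mo n →
                   n ≡ nf ⊕₁ₑ ⊎ n ≡ nf ⊕₂ₑ
xor-normal-forms ⟨ _ , _ , _ , _ ∣ m ⟩ is-xor swap-m≡m
  with is-xor true true | is-xor true false | is-xor false true | is-xor false false
     | swap-fixed m swap-m≡m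
... | refl | refl | refl | refl | inj₁ refl = inj₁ refl
... | refl | refl | refl | refl | inj₂ refl = inj₂ refl

module Classification (c ℓ : Level) where

  ⊕₁-isRLSE : (L : OrthomodularLattice c ℓ) → RLSEover L (_⊕₁_ L)
  ⊕₁-isRLSE L = RLSEProperties.RLSEover-byNormalForms L ⊕₁ₑ ⊕₁-laws

  ⊕₂-isRLSE : (L : OrthomodularLattice c ℓ) → RLSEover L (_⊕₂_ L)
  ⊕₂-isRLSE L = RLSEProperties.RLSEover-byNormalForms L ⊕₂ₑ ⊕₂-laws

  equivTo-byNormalForm : ∀ t p → fromTerm t ≐ p →
    (L : OrthomodularLattice c ℓ) → ∀ x y →
    OrthomodularLattice._≈_ L (⟦_⟧ L t x y) (OrthomodularLatticeProperties.⟦_⟧ₑ L p x y)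
  equivTo-byNormalForm t p t≐p L x y = trans (reflexive (⟦⟧≡⟦fromTerm⟧ₑ t x y)) (≈-by-nf t≐p x y)
    where open OrthomodularLatticeProperties L

  open OrthomodularLatticeProperties (mo₂ c ℓ)
  open SetoidReasoning (Lattice.setoid lattice)

  mo-interpretation : IsInterpretation (λ n → lift (mo n)) (lift X) (lift Y)
  mo-interpretation = record
    { h-x = lift refl ; h-y = lift refl ; h-⊤ = lift refl
    ; h-∨ = λ _ _ → lift refl ; h-′ = λ _ → lift refl }

  swapped-interpretation : IsInterpretation (λ n → lift (swap (mo n))) (lift Y) (lift X)
  swapped-interpretation = record
    { h-x = lift refl ; h-y = lift refl ; h-⊤ = lift refl
    ; h-∨ = λ n k → lift (swap-⊔ (mo n) (mo k)) ; h-′ = λ n → lift (swap-ᶜ (mo n)) }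

  ⊤≉⊥ : ¬ ⊤ ≈ ⊥
  ⊤≉⊥ (lift ())

  defines⇒normalForm : ∀ t → DefinesRLSE c ℓ t → fromTerm t ≐ ⊕₁ₑ ⊎ fromTerm t ≐ ⊕₂ₑ
  defines⇒normalForm t defines = Sum.map same-nf same-nf (xor-normal-forms n table-xor swap-mo≡mo)
    where
    n = nf (fromTerm t)
    rlse = defines (mo₂ c ℓ)
    open IsInterpretation using (interpret)

    table-xor : ∀ u v → table u v n ≡ u xor v
    table-xor u v = keep-⊤-injective ⊤≉⊥ (begin
      keep (table u v n) ⊤                   ≈⟨ interpret (boolean-point u v) (fromTerm t) ⟨
      ⟦ fromTerm t ⟧ₑ (keep u ⊤) (keep v ⊤)  ≡⟨ ⟦⟧≡⟦fromTerm⟧ₑ t _ _ ⟨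
      ⟦_⟧ (mo₂ c ℓ) t (keep u ⊤) (keep v ⊤)  ≈⟨ RLSEProperties.⊕-bounds-xor (mo₂ c ℓ) rlse u v ⟩
      keep (u xor v) ⊤                       ∎)

    swap-mo≡mo : swap (mo n) ≡ mo n
    swap-mo≡mo = lower (begin
      lift (swap (mo n))                  ≈⟨ interpret swapped-interpretation (fromTerm t) ⟨
      ⟦ fromTerm t ⟧ₑ (lift Y) (lift X)   ≡⟨ ⟦⟧≡⟦fromTerm⟧ₑ t _ _ ⟨
      ⟦_⟧ (mo₂ c ℓ) t (lift Y) (lift X)   ≈⟨ IsRLSE.R1 (proj₁ rlse) _ _ ⟩
      ⟦_⟧ (mo₂ c ℓ) t (lift X) (lift Y)   ≡⟨ ⟦⟧≡⟦fromTerm⟧ₑ t _ _ ⟩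
      ⟦ fromTerm t ⟧ₑ (lift X) (lift Y)   ≈⟨ interpret mo-interpretation (fromTerm t) ⟩
      lift (mo n)                         ∎)

  defines⇒equivTo : ∀ t → DefinesRLSE c ℓ t → EquivTo c ℓ t _⊕₁_ ⊎ EquivTo c ℓ t _⊕₂_
  defines⇒equivTo t defines =
    Sum.map (equivTo-byNormalForm t ⊕₁ₑ) (equivTo-byNormalForm t ⊕₂ₑ) (defines⇒normalForm t defines)

  equivTo⇒defines : ∀ t → EquivTo c ℓ t _⊕₁_ ⊎ EquivTo c ℓ t _⊕₂_ → DefinesRLSE c ℓ t
  equivTo⇒defines t (inj₁ t≈⊕₁) L = RLSEProperties.RLSEover-resp L (t≈⊕₁ L) (⊕₁-isRLSE L)
  equivTo⇒defines t (inj₂ t≈⊕₂) L = RLSEProperties.RLSEover-resp L (t≈⊕₂ L) (⊕₂-isRLSE L)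

  ⊕₁≉⊕₂ : ¬ ((L : OrthomodularLattice c ℓ) → ∀ x y →
              OrthomodularLattice._≈_ L (_⊕₁_ L x y) (_⊕₂_ L x y))
  ⊕₁≉⊕₂ ⊕₁≈⊕₂ with ⊕₁≈⊕₂ (mo₂ c ℓ) (lift X) (lift Y)
  ... | lift ()

theorem3p2 : (c ℓ : Level) →
    -- (i) both ⊕₁ and ⊕₂ make every OML L an RLSE R with 𝕃(R) = L
    ((L : OrthomodularLattice c ℓ) → RLSEover L (_⊕₁_ L) × RLSEover L (_⊕₂_ L))
    -- (ii) a binary term in ∨,∧,′ does so iff it is equivalent to ⊕₁ or to ⊕₂ over OMLs
    × ((t : Term) → DefinesRLSE c ℓ t ⇔ (EquivTo c ℓ t _⊕₁_ ⊎ EquivTo c ℓ t _⊕₂_))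
    -- (iii) ⊕₁ and ⊕₂ are genuinely different (so there are exactly two)
    × ¬ ((L : OrthomodularLattice c ℓ) → ∀ x y →
           OrthomodularLattice._≈_ L (_⊕₁_ L x y) (_⊕₂_ L x y))
theorem3p2 c ℓ =
  (λ L → ⊕₁-isRLSE L , ⊕₂-isRLSE L) ,
  (λ t → mk⇔ (defines⇒equivTo t) (equivTo⇒defines t)) ,
  ⊕₁≉⊕₂
  where open Classification c ℓ
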